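{- Let $k \geq 1$ and let $A_1,\dots,A_{2k-1}$ be balanced parenthesis sequences inducing ordered matchings $M_1,\dots,M_{2k-1}$. Let $M$ be the ordered matching induced by the balanced parenthesis sequence $$(A_1(A_2(\cdots(A_{k-1}(A_k)A_{k+1})\cdots)A_{2k-2})A_{2k-1}).$$ Set $l = \sum_{i \neq k} r_<(M_i, K_3)$ and $t = r_<(M_k, K_3)$. Then $$r_<(M, K_3) \leq t + 20\big(k + l + |M_k|\big),$$ where $|M_k|$ denotes the number of vertices of $M_k$.
   Context: An ordered graph on $n$ vertices is a graph whose vertex set is $\{1,\dots,n\}$ with its natural order; an ordered matching is one in which every vertex has degree exactly $1$ (the empty matching on $0$ vertices is allowed). A balanced parenthesis sequence is a finite string of symbols "(" and ")" that is correctly matched; one of length $2m$ induces the ordered matching on $\{1,\dots,2m\}$ whose edges are the pairs of positions $\{i,j\}$ holding matched parentheses. A copy of an ordered graph $G$ on $\{1,\dots,m\}$ inside an edge-colored ordered complete graph on $\{1,\dots,N\}$ is an increasing map from $\{1,\dots,m\}$ to $\{1,\dots,N\}$ sending every edge of $G$ to an edge; it is red (resp. blue) if all image edges are red (resp. blue). For ordered graphs $G,H$, $r_<(G,H)$ is the smallest nonnegative integer $N$ such that every red/blue coloring of the edges of the ordered complete graph on $\{1,\dots,N\}$ contains a red copy of $G$ or a blue copy of $H$. $K_3$ is the triangle. -}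

module Defs where

open import Data.Nat using (ℕ; zero; suc; _+_; _*_; _∸_; _≤_; _<_)
open import Data.Fin using (Fin; toℕ)
import Data.Fin as F
open import Data.Bool using (Bool; true; false)
open import Data.List using (List; []; _∷_; _++_; [_]; length; map; upTo)
open import Data.Nat.ListAction using (sum)
open import Data.List.Membership.Propositional using (_∈_)
open import Data.Product using (_×_; _,_; Σ; ∃)
open import Data.Sum using (_⊎_)
open import Relation.Binary.PropositionalEquality using (_≡_; _≢_)

-- Ordered graphs: vertex set Fin n = {0,…,n-1} (i.e. {1,…,n} shifted),
-- with its natural order, and a (symmetric) edge relation.

record OGraph : Set₁ where
  field
    n : ℕ
    E : Fin n → Fin n → Set
open OGraph public

K3 : OGraph
K3 = record { n = 3 ; E = λ i j → i ≢ j }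

data Paren : Set where
  op cl : Paren

data Balanced : List Paren → Set where
  bal-nil  : Balanced []
  bal-wrap : ∀ {a b} → Balanced a → Balanced b → Balanced (op ∷ a ++ cl ∷ b)

-- Matched pairs of positions (0-based), computed with a stack.
pairsGo : ℕ → List ℕ → List Paren → List (ℕ × ℕ)
pairsGo p st       []       = []
pairsGo p st       (op ∷ s) = pairsGo (suc p) (p ∷ st) s
pairsGo p (q ∷ st) (cl ∷ s) = (q , p) ∷ pairsGo (suc p) st s
pairsGo p []       (cl ∷ s) = pairsGo (suc p) [] s

matchedPairs : List Paren → List (ℕ × ℕ)
matchedPairs = pairsGo 0 []

inducedMatching : List Paren → OGraph
inducedMatching s = record
  { n = length s
  ; E = λ i j → ((toℕ i , toℕ j) ∈ matchedPairs s) ⊎ ((toℕ j , toℕ i) ∈ matchedPairs s)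
  }

-- A red/blue colouring of the edges of the ordered complete graph on Fin N:
-- the colour of edge {x,y} with x < y is c x y (true = red, false = blue).
Colouring : ℕ → Set
Colouring N = Fin N → Fin N → Bool

MonoCopy : (G : OGraph) (N : ℕ) → Colouring N → Bool → Set
MonoCopy G N c b =
  Σ (Fin (n G) → Fin N) λ f →
    (∀ i j → i F.< j → f i F.< f j) ×
    (∀ i j → i F.< j → E G i j → c (f i) (f j) ≡ b)

Arrows : OGraph → OGraph → ℕ → Set
Arrows G H N = ∀ (c : Colouring N) → MonoCopy G N c true ⊎ MonoCopy H N c false

IsOrdRamsey : OGraph → OGraph → ℕ → Set
IsOrdRamsey G H N = Arrows G H N × (∀ N′ → Arrows G H N′ → N ≤ N′)

-- The nested sequence (A_1(A_2(⋯(A_{k-1}(A_k)A_{k+1})⋯)A_{2k-2})A_{2k-1}).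
-- Sequences are indexed by ℕ; only indices 1,…,2k-1 are used.
-- nestLayer A k 0 = (A_k),
-- nestLayer A k (j+1) = ( A_{k-j-1} (nestLayer A k j) A_{k+j+1} ).

nestLayer : (ℕ → List Paren) → ℕ → ℕ → List Paren
nestLayer A k zero    = op ∷ A k ++ [ cl ]
nestLayer A k (suc j) = op ∷ A (k ∸ suc j) ++ nestLayer A k j ++ A (k + suc j) ++ [ cl ]

nested : (ℕ → List Paren) → ℕ → List Paren
nested A k = nestLayer A k (k ∸ 1)

sumExceptMiddle : (ℕ → ℕ) → ℕ → ℕ
sumExceptMiddle r k =
  sum (map (λ j → r (suc j)) (upTo (k ∸ 1))) + sum (map (λ j → r (k + suc j)) (upTo (k ∸ 1)))

module Submission where

-- Put t = r(A_k), L = Σ_{i≠k} r(A_i), D = |M|, let G = (k - 1) + L be the total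
-- size of the gaps reserved for the k - 1 outer layers, Λ = 2G + 1, and colour
-- K_N with N = Λ + t + 2D + Λ.  In each of 2D columns s every left end x < Λ is
-- paired with a right end "partner x s", and these pairs are nested.  Scanning a
-- column greedily either finds k red pairs with the prescribed gaps, into which
-- A_k (placed in [Λ, Λ + t)) and the other A_i fit by the arrow property of
-- r(A_i), giving a red M; or it skips at most G red pairs.  If the latter holds
-- in every column, double counting gives a left end x with D blue edges to its
-- partners, whose other ends span a red clique (containing M) or, with x, a
-- blue triangle.  So M arrows K₃ on N vertices; since the arrow property is
-- decidable, r_<(M, K₃) exists and is at most N ≤ t + 20(k + L + |A_k|).

open import Defs
open import Data.Nat using (ℕ; zero; suc; _+_; _*_; _^_; _∸_; _≤_; _<_; z≤n; s≤s)
import Data.Nat as ℕ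
import Data.Nat.Properties as ℕP
open import Data.Nat.ListAction using (sum)
open import Data.Nat.Tactic.RingSolver using (solve-∀)
open import Data.List using (List; []; _∷_; _++_; [_]; length; map; upTo; applyUpTo)
import Data.List.Properties as ListP
open import Data.List.Membership.Propositional using (_∈_)
open import Data.List.Membership.Propositional.Properties using (∈-map⁻; ∈-++⁻)
open import Data.List.Relation.Unary.Any using (here; there)
open import Data.List.Relation.Unary.All using (All; []; _∷_)
import Data.List.Relation.Unary.All as All
open import Data.Product using (_×_; _,_; Σ; ∃; ∃₂; proj₁; proj₂; map₂)
import Data.Product.Properties as ProductP
open import Data.Sum using (_⊎_; inj₁; inj₂)
import Data.Sum as Sum
open import Data.Empty using (⊥; ⊥-elim)
open import Data.Fin using (Fin; toℕ; fromℕ<; finToFun; funToFin) renaming (zero to fz; suc to fs)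
import Data.Fin as Fin
import Data.Fin.Properties as FinP
open import Data.Bool using (Bool; true; false)
import Data.Bool.Properties as BoolP
open import Function using (_∘_; Inverse)
open import Relation.Nullary using (Dec; yes; no)
open import Relation.Nullary.Decidable using (map′; _×-dec_; _⊎-dec_; _→-dec_; ¬?)
open import Relation.Binary.Definitions using (tri<; tri≈; tri>)
open import Data.List.Membership.DecPropositional (ProductP.≡-dec ℕP._≟_ ℕP._≟_) using (_∈?_)
open import Relation.Binary.PropositionalEquality hiding ([_])

balanced-++ : ∀ {a b} → Balanced a → Balanced b → Balanced (a ++ b)
balanced-++ bal-nil bb = bb
balanced-++ (bal-wrap {a₁} {a₂} b₁ b₂) bb =
  subst Balanced (cong (op ∷_) (sym (ListP.++-assoc a₁ (cl ∷ a₂) _))) (bal-wrap b₁ (balanced-++ b₂ bb))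

-- Scanning a balanced block neither consumes nor depends on the stack:
-- its pairs come first, and the scan resumes with the old stack after it.
pairsGo-++ : ∀ {a} → Balanced a → ∀ p st st′ s →
  pairsGo p st (a ++ s) ≡ pairsGo p st′ a ++ pairsGo (p + length a) st s
pairsGo-++ bal-nil p st st′ s = cong (λ q → pairsGo q st s) (sym (ℕP.+-identityʳ p))
pairsGo-++ (bal-wrap {a₁} {a₂} b₁ b₂) p st st′ s = begin
    pairsGo (suc p) (p ∷ st) ((a₁ ++ cl ∷ a₂) ++ s)
  ≡⟨ cong (pairsGo (suc p) (p ∷ st)) (ListP.++-assoc a₁ (cl ∷ a₂) s) ⟩
    pairsGo (suc p) (p ∷ st) (a₁ ++ cl ∷ a₂ ++ s)
  ≡⟨ pairsGo-++ b₁ (suc p) (p ∷ st) (p ∷ st′) (cl ∷ a₂ ++ s) ⟩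
    P₁ ++ (p , m) ∷ pairsGo (suc m) st (a₂ ++ s)
  ≡⟨ cong (λ z → P₁ ++ (p , m) ∷ z) (pairsGo-++ b₂ (suc m) st st′ s) ⟩
    P₁ ++ (p , m) ∷ (P₂ ++ pairsGo (suc m + length a₂) st s)
  ≡⟨ sym (ListP.++-assoc P₁ ((p , m) ∷ P₂) _) ⟩
    (P₁ ++ (p , m) ∷ P₂) ++ pairsGo (suc m + length a₂) st s
  ≡⟨ cong₂ _++_ (sym (pairsGo-++ b₁ (suc p) (p ∷ st′) (p ∷ st′) (cl ∷ a₂)))
                (cong (λ q → pairsGo q st s) length-eq) ⟩
    pairsGo (suc p) (p ∷ st′) (a₁ ++ cl ∷ a₂) ++ pairsGo (p + length (op ∷ a₁ ++ cl ∷ a₂)) st s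
  ∎
  where
  open ≡-Reasoning
  m = suc p + length a₁
  P₁ = pairsGo (suc p) (p ∷ st′) a₁
  P₂ = pairsGo (suc m) st′ a₂
  arith : ∀ p a b → suc (suc p + a) + b ≡ p + suc (a + suc b)
  arith = solve-∀
  length-eq : suc m + length a₂ ≡ p + length (op ∷ a₁ ++ cl ∷ a₂)
  length-eq = trans (arith p (length a₁) (length a₂)) (cong (λ z → p + suc z) (sym (ListP.length-++ a₁)))

shiftPair : ℕ → ℕ × ℕ → ℕ × ℕ
shiftPair d (q , p) = d + q , d + p

pairsGo-shift : ∀ d p st s → pairsGo (d + p) (map (d +_) st) s ≡ map (shiftPair d) (pairsGo p st s)
pairsGo-shift d p st [] = refl
pairsGo-shift d p st (op ∷ s) =
  trans (cong (λ q → pairsGo q (map (d +_) (p ∷ st)) s) (sym (ℕP.+-suc d p)))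
        (pairsGo-shift d (suc p) (p ∷ st) s)
pairsGo-shift d p (q ∷ st) (cl ∷ s) =
  cong ((d + q , d + p) ∷_) (trans (cong (λ x → pairsGo x (map (d +_) st) s) (sym (ℕP.+-suc d p)))
                                   (pairsGo-shift d (suc p) st s))
pairsGo-shift d p [] (cl ∷ s) =
  trans (cong (λ q → pairsGo q [] s) (sym (ℕP.+-suc d p))) (pairsGo-shift d (suc p) [] s)

pairsGo-bounds : ∀ p st s q p′ → All (_< p) st → (q , p′) ∈ pairsGo p st s → q < p′ × p′ < p + length s
pairsGo-bounds p st [] q p′ _ ()
pairsGo-bounds p st (op ∷ s) q p′ st<p mem =
  map₂ (subst (p′ <_) (sym (ℕP.+-suc p (length s))))
       (pairsGo-bounds (suc p) (p ∷ st) s q p′ (ℕP.n<1+n p ∷ All.map ℕP.m<n⇒m<1+n st<p) mem)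
pairsGo-bounds p (q₁ ∷ st) (cl ∷ s) q p′ (q₁<p ∷ _) (here refl) = q₁<p , ℕP.m<m+n p (s≤s z≤n)
pairsGo-bounds p (q₁ ∷ st) (cl ∷ s) q p′ (_ ∷ st<p) (there mem) =
  map₂ (subst (p′ <_) (sym (ℕP.+-suc p (length s))))
       (pairsGo-bounds (suc p) st s q p′ (All.map ℕP.m<n⇒m<1+n st<p) mem)
pairsGo-bounds p [] (cl ∷ s) q p′ [] mem =
  map₂ (subst (p′ <_) (sym (ℕP.+-suc p (length s)))) (pairsGo-bounds (suc p) [] s q p′ [] mem)

matchedPair-bounds : ∀ s {q p} → (q , p) ∈ matchedPairs s → q < p × p < length s
matchedPair-bounds s {q} {p} = pairsGo-bounds 0 [] s q p []

matchedPairs-++ : ∀ {a} → Balanced a → ∀ b →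
  matchedPairs (a ++ b) ≡ matchedPairs a ++ map (shiftPair (length a)) (matchedPairs b)
matchedPairs-++ {a} bal-a b = begin
    pairsGo 0 [] (a ++ b)
  ≡⟨ pairsGo-++ bal-a 0 [] [] b ⟩
    matchedPairs a ++ pairsGo (length a) [] b
  ≡⟨ cong (λ p → matchedPairs a ++ pairsGo p [] b) (sym (ℕP.+-identityʳ (length a))) ⟩
    matchedPairs a ++ pairsGo (length a + 0) [] b
  ≡⟨ cong (matchedPairs a ++_) (pairsGo-shift (length a) 0 [] b) ⟩
    matchedPairs a ++ map (shiftPair (length a)) (matchedPairs b)
  ∎
  where open ≡-Reasoning

matchedPairs-wrap : ∀ {a} → Balanced a →
  matchedPairs (op ∷ a ++ [ cl ]) ≡ map (shiftPair 1) (matchedPairs a) ++ [ (0 , suc (length a)) ]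
matchedPairs-wrap {a} bal-a = trans (pairsGo-++ bal-a 1 (0 ∷ []) [] [ cl ])
                                    (cong (_++ [ (0 , suc (length a)) ]) (pairsGo-shift 1 0 [] a))

sumBelow : (ℕ → ℕ) → ℕ → ℕ
sumBelow f zero = 0
sumBelow f (suc n) = f 0 + sumBelow (f ∘ suc) n

sumBelow-cong : ∀ n {f g} → (∀ i → i < n → f i ≡ g i) → sumBelow f n ≡ sumBelow g n
sumBelow-cong zero f≗g = refl
sumBelow-cong (suc n) f≗g = cong₂ _+_ (f≗g 0 (s≤s z≤n)) (sumBelow-cong n λ i i<n → f≗g (suc i) (s≤s i<n))

sumBelow-mono : ∀ n {f g} → (∀ i → i < n → f i ≤ g i) → sumBelow f n ≤ sumBelow g n
sumBelow-mono zero f≤g = z≤n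
sumBelow-mono (suc n) f≤g = ℕP.+-mono-≤ (f≤g 0 (s≤s z≤n)) (sumBelow-mono n λ i i<n → f≤g (suc i) (s≤s i<n))

sumBelow-const : ∀ n c → sumBelow (λ _ → c) n ≡ n * c
sumBelow-const zero c = refl
sumBelow-const (suc n) c = cong (c +_) (sumBelow-const n c)

sumBelow-+ : ∀ n f g → sumBelow (λ i → f i + g i) n ≡ sumBelow f n + sumBelow g n
sumBelow-+ zero f g = refl
sumBelow-+ (suc n) f g = trans (cong (f 0 + g 0 +_) (sumBelow-+ n (f ∘ suc) (g ∘ suc)))
                               (interchange (f 0) (g 0) _ _)
  where
  interchange : ∀ a b c d → a + b + (c + d) ≡ a + c + (b + d)
  interchange = solve-∀

sumBelow-swap : ∀ m n (F : ℕ → ℕ → ℕ) →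
  sumBelow (λ j → sumBelow (λ i → F i j) n) m ≡ sumBelow (λ i → sumBelow (F i) m) n
sumBelow-swap zero n F = sym (trans (sumBelow-const n 0) (ℕP.*-zeroʳ n))
sumBelow-swap (suc m) n F =
  trans (cong (sumBelow (λ i → F i 0) n +_) (sumBelow-swap m n (λ i j → F i (suc j))))
        (sym (sumBelow-+ n (λ i → F i 0) (λ i → sumBelow (F i ∘ suc) m)))

sumBelow-split : ∀ g m f → sumBelow f (g + m) ≡ sumBelow f g + sumBelow (λ i → f (g + i)) m
sumBelow-split zero m f = refl
sumBelow-split (suc g) m f = trans (cong (f 0 +_) (sumBelow-split g m (f ∘ suc))) (sym (ℕP.+-assoc (f 0) _ _))

sumBelow-snoc : ∀ n f → sumBelow f (suc n) ≡ sumBelow f n + f n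
sumBelow-snoc zero f = ℕP.+-comm (f 0) 0
sumBelow-snoc (suc n) f = trans (cong (f 0 +_) (sumBelow-snoc n (f ∘ suc))) (sym (ℕP.+-assoc (f 0) _ _))

sumBelow-reverse : ∀ n f → sumBelow f n ≡ sumBelow (λ i → f (n ∸ suc i)) n
sumBelow-reverse zero f = refl
sumBelow-reverse (suc n) f =
  trans (sumBelow-snoc n f) (trans (ℕP.+-comm _ (f n)) (cong (f n +_) (sumBelow-reverse n f)))

sum-map-upTo : ∀ n f → sum (map f (upTo n)) ≡ sumBelow f n
sum-map-upTo n f = trans (cong sum (ListP.map-upTo f n)) (sum-applyUpTo n f)
  where
  sum-applyUpTo : ∀ n f → sum (applyUpTo f n) ≡ sumBelow f n
  sum-applyUpTo zero f = refl
  sum-applyUpTo (suc n) f = cong (f 0 +_) (sum-applyUpTo n (f ∘ suc))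

bounded-choice : {P Q : ℕ → Set} → ∀ m → (∀ s → P s ⊎ Q s) → (∃ λ s → s < m × P s) ⊎ (∀ s → s < m → Q s)
bounded-choice zero choice = inj₂ λ s ()
bounded-choice {P} {Q} (suc m) choice with bounded-choice m choice | choice m
... | inj₁ (s , s<m , Ps) | _ = inj₁ (s , ℕP.m<n⇒m<1+n s<m , Ps)
... | inj₂ _ | inj₁ Pm = inj₁ (m , ℕP.n<1+n m , Pm)
... | inj₂ below | inj₂ Qm = inj₂ λ s s<1+m → last (ℕP.m≤n⇒m<n∨m≡n (ℕ.s≤s⁻¹ s<1+m))
  where
  last : ∀ {s} → s < m ⊎ s ≡ m → Q s
  last (inj₁ s<m) = below _ s<m
  last (inj₂ refl) = Qm

bool-cases : ∀ b → b ≡ false ⊎ b ≡ true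
bool-cases false = inj₁ refl
bool-cases true = inj₂ refl

all-pairs-or-failure : ∀ D (Q : ℕ → ℕ → Bool) →
  (∃₂ λ i j → i < j × j < D × Q i j ≡ false) ⊎ (∀ i j → i < j → j < D → Q i j ≡ true)
all-pairs-or-failure D Q with bounded-choice D (λ j → bounded-choice j (λ i → bool-cases (Q i j)))
... | inj₁ (j , j<D , i , i<j , fails) = inj₁ (i , j , i<j , j<D , fails)
... | inj₂ holds = inj₂ λ i j i<j j<D → holds j j<D i i<j

blueIndicator : Bool → ℕ
blueIndicator true = 0
blueIndicator false = 1

BlueListing : (ℕ → Bool) → ℕ → ℕ → (ℕ → ℕ) → Set
BlueListing P S D g =
  (∀ i → i < D → g i < S) × (∀ i j → i < j → j < D → g i < g j) × (∀ i → i < D → P (g i) ≡ false)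

blue-positions : (P : ℕ → Bool) → ∀ S D → D ≤ sumBelow (blueIndicator ∘ P) S → Σ (ℕ → ℕ) (BlueListing P S D)
blue-positions P S zero _ = (λ i → i) , (λ i ()) , (λ i j _ ()) , (λ i ())
blue-positions P zero (suc D) ()
blue-positions P (suc S) (suc D) D≤ with P 0 in P0
... | true with blue-positions (P ∘ suc) S (suc D) D≤
...   | g , g<S , g-inc , g-blue =
  suc ∘ g , (λ i i<D → s≤s (g<S i i<D)) , (λ i j i<j j<D → s≤s (g-inc i j i<j j<D)) , g-blue
blue-positions P (suc S) (suc D) (s≤s D≤) | false with blue-positions (P ∘ suc) S D D≤
... | g , g<S , g-inc , g-blue = h , h<S , h-inc , h-blue
  where
  h : ℕ → ℕ
  h zero = 0
  h (suc i) = suc (g i)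
  h<S : ∀ i → i < suc D → h i < suc S
  h<S zero _ = s≤s z≤n
  h<S (suc i) (s≤s i<D) = s≤s (g<S i i<D)
  h-inc : ∀ i j → i < j → j < suc D → h i < h j
  h-inc zero (suc j) _ _ = s≤s z≤n
  h-inc (suc i) (suc j) (s≤s i<j) (s≤s j<D) = s≤s (g-inc i j i<j j<D)
  h-blue : ∀ i → i < suc D → P (h i) ≡ false
  h-blue zero _ = P0
  h-blue (suc i) (s≤s i<D) = g-blue i i<D

double-counting : ∀ D G (B : ℕ → ℕ → Bool) →
  (∀ x → x < suc (G + G) → sumBelow (λ s → blueIndicator (B x s)) (D + D) < D) →
  (∀ s → s < D + D → suc (G + G) ≤ sumBelow (λ x → blueIndicator (B x s)) (suc (G + G)) + G) → ⊥
double-counting D G B rows columns = ℕP.<-irrefl refl (ℕP.<-≤-trans (ℕP.m<m+n total (s≤s z≤n)) too-many)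
  where
  Λ = suc (G + G)
  S = D + D
  row column : ℕ → ℕ
  row x = sumBelow (λ s → blueIndicator (B x s)) S
  column s = sumBelow (λ x → blueIndicator (B x s)) Λ
  blue total : ℕ
  blue = sumBelow row Λ
  total = Λ * D + S * G
  columns-sum : sumBelow (λ s → column s + G) S ≡ blue + S * G
  columns-sum = trans (sumBelow-+ S column (λ _ → G))
                      (cong₂ _+_ (sumBelow-swap S Λ (λ x s → blueIndicator (B x s))) (sumBelow-const S G))
  rows-sum : sumBelow (λ x → suc (row x)) Λ ≡ Λ * 1 + blue
  rows-sum = trans (sumBelow-+ Λ (λ _ → 1) row) (cong (_+ blue) (sumBelow-const Λ 1))
  by-columns : S * Λ ≤ blue + S * G
  by-columns = subst₂ _≤_ (sumBelow-const S Λ) columns-sum (sumBelow-mono S columns)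
  by-rows : Λ * 1 + blue ≤ Λ * D
  by-rows = subst₂ _≤_ rows-sum (sumBelow-const Λ D) (sumBelow-mono Λ rows)
  identity : ∀ D G →
    (D + D) * suc (G + G) + suc (G + G) * 1 ≡ suc (G + G) * D + (D + D) * G + suc (D + (G + G))
  identity = solve-∀
  rearrange : ∀ b u v → b + u + v ≡ v + b + u
  rearrange = solve-∀
  -- Combining both counts, S Λ + Λ ≤ Λ D + S G; but the left side exceeds
  -- the right one by D + 2G + 1.
  too-many : total + suc (D + (G + G)) ≤ total
  too-many = begin
      total + suc (D + (G + G))
    ≡⟨ sym (identity D G) ⟩
      S * Λ + Λ * 1
    ≤⟨ ℕP.+-monoˡ-≤ (Λ * 1) by-columns ⟩
      blue + S * G + Λ * 1
    ≡⟨ rearrange blue (S * G) (Λ * 1) ⟩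
      Λ * 1 + blue + S * G
    ≤⟨ ℕP.+-monoˡ-≤ (S * G) by-rows ⟩
      total
    ∎
    where open ℕP.≤-Reasoning

-- A property of maps Fin m → Fin n which is invariant under pointwise
-- equality and decidable for each map is decidable for some / all maps:
-- the maps are enumerated by their codes in Fin (n ^ m).
module _ {m n : ℕ} (P : (Fin m → Fin n) → Set)
         (resp : ∀ {f g} → (∀ i → f i ≡ g i) → P f → P g) (P? : ∀ f → Dec (P f)) where

  any-map? : Dec (∃ P)
  any-map? = map′ (λ (c , p) → finToFun c , p)
                  (λ (f , p) → funToFin f , resp (sym ∘ FinP.finToFun-funToFin f) p)
                  (FinP.any? (P? ∘ finToFun))

  all-map? : Dec (∀ f → P f)
  all-map? = map′ (λ h f → resp (FinP.finToFun-funToFin f) (h (funToFin f)))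
                  (λ h c → h (finToFun c))
                  (FinP.all? (P? ∘ finToFun))

-- Colourings of K_N, coded as maps Fin N → Fin (2 ^ N) (one row per vertex).
decodeColouring : ∀ {N} → (Fin N → Fin (2 ^ N)) → Colouring N
decodeColouring g x y = Inverse.to FinP.2↔Bool (finToFun (g x) y)

encodeColouring : ∀ {N} → Colouring N → Fin N → Fin (2 ^ N)
encodeColouring c x = funToFin (λ y → Inverse.from FinP.2↔Bool (c x y))

decode-encode : ∀ {N} (c : Colouring N) x y → decodeColouring (encodeColouring c) x y ≡ c x y
decode-encode c x y = trans (cong (Inverse.to FinP.2↔Bool) (FinP.finToFun-funToFin _ y))
                            (Inverse.strictlyInverseˡ FinP.2↔Bool (c x y))

monoCopy-resp : ∀ G {N} {c c′ : Colouring N} {b} → (∀ x y → c x y ≡ c′ x y) →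
  MonoCopy G N c b → MonoCopy G N c′ b
monoCopy-resp G c≗c′ (f , inc , col) = f , inc , λ i j i<j e → trans (sym (c≗c′ (f i) (f j))) (col i j i<j e)

DecEdges : OGraph → Set
DecEdges G = ∀ i j → Dec (E G i j)

IsMonoCopy : (G : OGraph) (N : ℕ) → Colouring N → Bool → (Fin (n G) → Fin N) → Set
IsMonoCopy G N c b f =
  (∀ i j → i Fin.< j → f i Fin.< f j) × (∀ i j → i Fin.< j → E G i j → c (f i) (f j) ≡ b)

monoCopy? : ∀ G → DecEdges G → ∀ N c b → Dec (MonoCopy G N c b)
monoCopy? G E? N c b = any-map? (IsMonoCopy G N c b) isCopy-resp λ f →
  (FinP.all? λ i → FinP.all? λ j → (i FinP.<? j) →-dec (f i FinP.<? f j)) ×-dec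
  (FinP.all? λ i → FinP.all? λ j → (i FinP.<? j) →-dec (E? i j →-dec (c (f i) (f j) BoolP.≟ b)))
  where
  isCopy-resp : ∀ {f g} → (∀ i → f i ≡ g i) → IsMonoCopy G N c b f → IsMonoCopy G N c b g
  isCopy-resp f≗g (inc , col) =
    (λ i j i<j → subst₂ Fin._<_ (f≗g i) (f≗g j) (inc i j i<j)) ,
    (λ i j i<j e → subst₂ (λ u v → c u v ≡ b) (f≗g i) (f≗g j) (col i j i<j e))

arrows? : ∀ G H → DecEdges G → DecEdges H → ∀ N → Dec (Arrows G H N)
arrows? G H G? H? N =
  map′ (λ h c → body-resp (decode-encode c) (h (encodeColouring c))) (λ h g → h (decodeColouring g))
       (all-map? (Body ∘ decodeColouring) code-resp (λ g → body? (decodeColouring g)))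
  where
  Body : Colouring N → Set
  Body c = MonoCopy G N c true ⊎ MonoCopy H N c false
  body? : ∀ c → Dec (Body c)
  body? c = monoCopy? G G? N c true ⊎-dec monoCopy? H H? N c false
  body-resp : ∀ {c c′} → (∀ x y → c x y ≡ c′ x y) → Body c → Body c′
  body-resp c≗c′ = Sum.map (monoCopy-resp G c≗c′) (monoCopy-resp H c≗c′)
  code-resp : ∀ {g g′} → (∀ x → g x ≡ g′ x) → Body (decodeColouring g) → Body (decodeColouring g′)
  code-resp g≗g′ = body-resp (λ x y → cong (λ z → Inverse.to FinP.2↔Bool (finToFun z y)) (g≗g′ x))

least : (P : ℕ → Set) → (∀ n → Dec (P n)) → ∀ m → (∃ λ n → n < m × P n) →
  ∃ λ R → P R × (∀ n → P n → R ≤ n)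
least P P? (suc m) (n , n<1+m , Pn) with ℕP.anyUpTo? P? m
... | yes below = least P P? m below
... | no ¬below = n , Pn , λ n′ Pn′ → ℕP.≮⇒≥ λ n′<n → ¬below (n′ , ℕP.<-≤-trans n′<n (ℕ.s≤s⁻¹ n<1+m) , Pn′)

ramsey-exists : ∀ G H → DecEdges G → DecEdges H → ∀ N → Arrows G H N →
  ∃ λ R → IsOrdRamsey G H R × R ≤ N
ramsey-exists G H G? H? N arrows with least (Arrows G H) (arrows? G H G? H?) (suc N) (N , ℕP.n<1+n N , arrows)
... | R , arrowsR , minimal = R , (arrowsR , minimal) , minimal N arrows

matching-edges? : ∀ s → DecEdges (inducedMatching s)
matching-edges? s i j = ((toℕ i , toℕ j) ∈? matchedPairs s) ⊎-dec ((toℕ j , toℕ i) ∈? matchedPairs s)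

K3-edges? : DecEdges K3
K3-edges? i j = ¬? (i FinP.≟ j)

-- A matching arrowing K₃ on R vertices has at most R vertices (colour
-- everything red: a red copy is an injection into Fin R).
length≤arrows : ∀ s R → Arrows (inducedMatching s) K3 R → length s ≤ R
length≤arrows s R arrows with arrows (λ _ _ → true)
... | inj₁ (F , F-inc , _) = FinP.injective⇒≤ {f = F} injective
  where
  injective : ∀ {x y} → F x ≡ F y → x ≡ y
  injective {x} {y} Fx≡Fy with FinP.<-cmp x y
  ... | tri< x<y _ _ = ⊥-elim (ℕP.<-irrefl (cong toℕ Fx≡Fy) (F-inc x y x<y))
  ... | tri≈ _ x≡y _ = x≡y
  ... | tri> _ _ y<x = ⊥-elim (ℕP.<-irrefl (cong toℕ (sym Fx≡Fy)) (F-inc y x y<x))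
... | inj₂ (T , _ , T-blue) with T-blue fz (fs fz) (s≤s z≤n) (λ ())
... | ()

join : ℕ → (ℕ → ℕ) → (ℕ → ℕ) → ℕ → ℕ
join n f g i with i ℕ.<? n
... | yes _ = f i
... | no _ = g (i ∸ n)

join-left : ∀ n f g {i} → i < n → join n f g i ≡ f i
join-left n f g {i} i<n with i ℕ.<? n
... | yes _ = refl
... | no i≮n = ⊥-elim (i≮n i<n)

join-right : ∀ n f g {i} → n ≤ i → join n f g i ≡ g (i ∸ n)
join-right n f g {i} n≤i with i ℕ.<? n
... | yes i<n = ⊥-elim (ℕP.<⇒≱ i<n n≤i)
... | no _ = refl

module RedEmbeddings (col : ℕ → ℕ → Bool) where

  Red : ℕ → ℕ → Set
  Red x y = col x y ≡ true

  record RedEmbedding (s : List Paren) (f : ℕ → ℕ) (lo hi : ℕ) : Set where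
    constructor mkRedEmbedding
    field
      increasing : ∀ i j → i < j → j < length s → f i < f j
      in-range   : ∀ i → i < length s → lo ≤ f i × f i < hi
      red-pairs  : ∀ {q p} → (q , p) ∈ matchedPairs s → Red (f q) (f p)

  widen : ∀ {s f lo hi lo′ hi′} → lo′ ≤ lo → hi ≤ hi′ → RedEmbedding s f lo hi → RedEmbedding s f lo′ hi′
  widen {s} {f} {lo′ = lo′} {hi′} lo′≤lo hi≤hi′ (mkRedEmbedding inc rng red) = mkRedEmbedding inc rng′ red
    where
    rng′ : ∀ i → i < length s → lo′ ≤ f i × f i < hi′
    rng′ = λ i i<n → let (lo≤ , <hi) = rng i i<n in ℕP.≤-trans lo′≤lo lo≤ , ℕP.<-≤-trans <hi hi≤hi′

  clique : ∀ s f lo hi → (∀ i j → i < j → j < length s → f i < f j) →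
    (∀ i → i < length s → lo ≤ f i × f i < hi) → (∀ i j → i < j → j < length s → Red (f i) (f j)) →
    RedEmbedding s f lo hi
  clique s f lo hi inc rng red = mkRedEmbedding inc rng λ mem →
    let (q<p , p<n) = matchedPair-bounds s mem in red _ _ q<p p<n

  concat : ∀ {a b f g lo m hi} → Balanced a → lo ≤ m → m ≤ hi →
    RedEmbedding a f lo m → RedEmbedding b g m hi → RedEmbedding (a ++ b) (join (length a) f g) lo hi
  concat {a} {b} {f} {g} {lo} {m} {hi} bal-a lo≤m m≤hi ea eb = mkRedEmbedding inc rng red
    where
    module A = RedEmbedding ea
    module B = RedEmbedding eb
    na = length a
    h = join na f g
    right-position : ∀ {i} → na ≤ i → i < length (a ++ b) → i ∸ na < length b
    right-position {i} na≤i i<n =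
      ℕP.+-cancelˡ-< na _ _ (subst₂ _<_ (sym (ℕP.m+[n∸m]≡n na≤i)) (ListP.length-++ a) i<n)
    h-right : ∀ {i} → na ≤ i → i < length (a ++ b) → m ≤ h i × h i < hi
    h-right na≤i i<n rewrite join-right na f g na≤i = B.in-range _ (right-position na≤i i<n)
    h-shifted : ∀ i → h (na + i) ≡ g i
    h-shifted i = trans (join-right na f g (ℕP.m≤m+n na i)) (cong g (ℕP.m+n∸m≡n na i))
    inc : ∀ i j → i < j → j < length (a ++ b) → h i < h j
    inc i j i<j j<n with ℕP.<-≤-connex j na | ℕP.<-≤-connex i na
    ... | inj₁ j<na | _ rewrite join-left na f g (ℕP.<-trans i<j j<na) | join-left na f g j<na =
      A.increasing i j i<j j<na
    ... | inj₂ na≤j | inj₁ i<na rewrite join-left na f g i<na =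
      ℕP.<-≤-trans (proj₂ (A.in-range i i<na)) (proj₁ (h-right na≤j j<n))
    ... | inj₂ na≤j | inj₂ na≤i rewrite join-right na f g na≤i | join-right na f g na≤j =
      B.increasing _ _ (ℕP.∸-monoˡ-< i<j na≤i) (right-position na≤j j<n)
    rng : ∀ i → i < length (a ++ b) → lo ≤ h i × h i < hi
    rng i i<n with ℕP.<-≤-connex i na
    ... | inj₁ i<na rewrite join-left na f g i<na =
      let (lo≤ , <m) = A.in-range i i<na in lo≤ , ℕP.<-≤-trans <m m≤hi
    ... | inj₂ na≤i = let (m≤ , <hi) = h-right na≤i i<n in ℕP.≤-trans lo≤m m≤ , <hi
    red : ∀ {q p} → (q , p) ∈ matchedPairs (a ++ b) → Red (h q) (h p)
    red mem with ∈-++⁻ (matchedPairs a) (subst (_ ∈_) (matchedPairs-++ bal-a b) mem)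
    ... | inj₁ mem-a = let (q<p , p<na) = matchedPair-bounds a mem-a in
      subst₂ Red (sym (join-left na f g (ℕP.<-trans q<p p<na))) (sym (join-left na f g p<na))
                 (A.red-pairs mem-a)
    ... | inj₂ mem-b with ∈-map⁻ (shiftPair na) mem-b
    ...   | (q₀ , p₀) , mem₀ , refl = subst₂ Red (sym (h-shifted q₀)) (sym (h-shifted p₀)) (B.red-pairs mem₀)

  wrapMap : ℕ → ℕ → ℕ → (ℕ → ℕ) → ℕ → ℕ
  wrapMap x y na f zero = x
  wrapMap x y na f (suc i) = join na f (λ _ → y) i

  wrap : ∀ {X f x y} → Balanced X → x < y → Red x y → RedEmbedding X f (suc x) y →
    RedEmbedding (op ∷ X ++ [ cl ]) (wrapMap x y (length X) f) x (suc y)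
  wrap {X} {f} {x} {y} bal-X x<y red-xy eX = mkRedEmbedding inc rng red
    where
    module I = RedEmbedding eX
    na = length X
    W = wrapMap x y na f
    inner-length : ∀ {i} → suc i < length (op ∷ X ++ [ cl ]) → i ≤ na
    inner-length {i} i<n = ℕ.s≤s⁻¹ (subst (i <_) (trans (ListP.length-++ X) (ℕP.+-comm na 1)) (ℕ.s<s⁻¹ i<n))
    inner-range : ∀ i → i ≤ na → suc x ≤ W (suc i) × W (suc i) ≤ y
    inner-range i i≤na with ℕP.<-≤-connex i na
    ... | inj₁ i<na rewrite join-left na f (λ _ → y) i<na = map₂ ℕP.<⇒≤ (I.in-range i i<na)
    ... | inj₂ na≤i rewrite join-right na f (λ _ → y) na≤i = x<y , ℕP.≤-refl
    inc : ∀ i j → i < j → j < length (op ∷ X ++ [ cl ]) → W i < W j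
    inc zero (suc j) _ j<n = proj₁ (inner-range j (inner-length j<n))
    inc (suc i) (suc j) i<j j<n with ℕP.<-≤-connex j na
    ... | inj₁ j<na rewrite join-left na f (λ _ → y) (ℕP.<-trans (ℕ.s<s⁻¹ i<j) j<na)
                          | join-left na f (λ _ → y) j<na =
      I.increasing i j (ℕ.s<s⁻¹ i<j) j<na
    ... | inj₂ na≤j rewrite join-right na f (λ _ → y) na≤j =
      let i<na = ℕP.<-≤-trans (ℕ.s<s⁻¹ i<j) (inner-length j<n) in
      subst (_< y) (sym (join-left na f (λ _ → y) i<na)) (proj₂ (I.in-range i i<na))
    rng : ∀ i → i < length (op ∷ X ++ [ cl ]) → x ≤ W i × W i < suc y
    rng zero _ = ℕP.≤-refl , s≤s (ℕP.<⇒≤ x<y)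
    rng (suc i) i<n = let (x< , ≤y) = inner-range i (inner-length i<n) in ℕP.<⇒≤ x< , s≤s ≤y
    red : ∀ {q p} → (q , p) ∈ matchedPairs (op ∷ X ++ [ cl ]) → Red (W q) (W p)
    red mem with ∈-++⁻ (map (shiftPair 1) (matchedPairs X)) (subst (_ ∈_) (matchedPairs-wrap bal-X) mem)
    ... | inj₁ mem-X with ∈-map⁻ (shiftPair 1) mem-X
    ...   | (q₀ , p₀) , mem₀ , refl = let (q<p , p<na) = matchedPair-bounds X mem₀ in
      subst₂ Red (sym (join-left na f (λ _ → y) (ℕP.<-trans q<p p<na))) (sym (join-left na f (λ _ → y) p<na))
             (I.red-pairs mem₀)
    red mem | inj₂ (here refl) = subst (Red x) (sym (join-right na f (λ _ → y) ℕP.≤-refl)) red-xy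

module GreedyChain (R : ℕ → Bool) (gap : ℕ → ℕ) (Λ : ℕ) where

  Chain : ℕ → ℕ → Set
  Chain zero x₀ = Σ ℕ λ x → x₀ ≤ x × x < Λ × R x ≡ true
  Chain (suc j) x₀ = Σ ℕ λ x → x₀ ≤ x × x < Λ × R x ≡ true × Chain j (x + gap (suc j))

  gapTotal : ℕ → ℕ
  gapTotal j = sumBelow (gap ∘ suc) j

  blueFrom : ℕ → ℕ → ℕ
  blueFrom x₀ f = sumBelow (λ i → blueIndicator (R (x₀ + i))) f

  chain-start : ∀ j {x₀ x₁} → x₁ ≤ x₀ → Chain j x₀ → Chain j x₁
  chain-start zero x₁≤x₀ (x , x₀≤x , rest) = x , ℕP.≤-trans x₁≤x₀ x₀≤x , rest
  chain-start (suc j) x₁≤x₀ (x , x₀≤x , rest) = x , ℕP.≤-trans x₁≤x₀ x₀≤x , rest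

  chain-head : ∀ j {x₀} → Chain j x₀ → x₀ < Λ
  chain-head zero (x , x₀≤x , x<Λ , _) = ℕP.≤-<-trans x₀≤x x<Λ
  chain-head (suc j) (x , x₀≤x , x<Λ , _) = ℕP.≤-<-trans x₀≤x x<Λ

  blueFrom-suc : ∀ x₀ f → blueFrom x₀ (suc f) ≡ blueIndicator (R x₀) + blueFrom (suc x₀) f
  blueFrom-suc x₀ f = cong₂ _+_ (cong (blueIndicator ∘ R) (ℕP.+-identityʳ x₀))
                                (sumBelow-cong f λ i _ → cong (blueIndicator ∘ R) (ℕP.+-suc x₀ i))

  blueFrom-drop : ∀ x₀ g f → g ≤ f → blueFrom (x₀ + g) (f ∸ g) ≤ blueFrom x₀ f
  blueFrom-drop x₀ g f g≤f = begin
      blueFrom (x₀ + g) (f ∸ g)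
    ≡⟨ sumBelow-cong (f ∸ g) (λ i _ → cong (blueIndicator ∘ R) (ℕP.+-assoc x₀ g i)) ⟩
      sumBelow (λ i → blueIndicator (R (x₀ + (g + i)))) (f ∸ g)
    ≤⟨ ℕP.m≤n+m _ _ ⟩
      blueFrom x₀ g + sumBelow (λ i → blueIndicator (R (x₀ + (g + i)))) (f ∸ g)
    ≡⟨ sym (sumBelow-split g (f ∸ g) (λ i → blueIndicator (R (x₀ + i)))) ⟩
      blueFrom x₀ (g + (f ∸ g))
    ≡⟨ cong (blueFrom x₀) (ℕP.m+[n∸m]≡n g≤f) ⟩
      blueFrom x₀ f
    ∎
    where open ℕP.≤-Reasoning

  start<Λ : ∀ {x₀ f} → x₀ + suc f ≡ Λ → x₀ < Λ
  start<Λ {x₀} x₀+f≡Λ = subst (x₀ <_) x₀+f≡Λ (ℕP.m<m+n x₀ (s≤s z≤n))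

  -- The greedy scan of [x₀, Λ) (of length f): take the first red point and
  -- continue after its gap.  Either it finds a chain of depth j, or every
  -- point it skipped was blue, except for at most gapTotal j points.
  greedy : ∀ j f x₀ → x₀ + f ≡ Λ → Chain j x₀ ⊎ f ≤ blueFrom x₀ f + gapTotal j
  greedy j zero x₀ _ = inj₂ z≤n
  greedy j (suc f) x₀ x₀+f≡Λ with R x₀ in Rx₀
  ... | false = Sum.map (chain-start j (ℕP.n≤1+n x₀)) count-blue
                        (greedy j f (suc x₀) (trans (sym (ℕP.+-suc x₀ f)) x₀+f≡Λ))
    where
    blue-step : blueFrom x₀ (suc f) ≡ suc (blueFrom (suc x₀) f)
    blue-step = trans (blueFrom-suc x₀ f) (cong (λ b → blueIndicator b + blueFrom (suc x₀) f) Rx₀)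
    count-blue : f ≤ blueFrom (suc x₀) f + gapTotal j → suc f ≤ blueFrom x₀ (suc f) + gapTotal j
    count-blue f≤ = subst (λ b → suc f ≤ b + gapTotal j) (sym blue-step) (s≤s f≤)
  greedy zero (suc f) x₀ x₀+f≡Λ | true = inj₁ (x₀ , ℕP.≤-refl , start<Λ x₀+f≡Λ , Rx₀)
  greedy (suc j) (suc f) x₀ x₀+f≡Λ | true with gap (suc j) ℕ.≤? suc f
  ... | no g≰ = inj₂ (ℕP.≤-trans (ℕP.<⇒≤ (ℕP.≰⇒> g≰)) (ℕP.≤-trans g≤total (ℕP.m≤n+m _ (blueFrom x₀ (suc f)))))
    where
    g≤total : gap (suc j) ≤ gapTotal (suc j)
    g≤total = subst (gap (suc j) ≤_) (sym (sumBelow-snoc j (gap ∘ suc))) (ℕP.m≤n+m _ (gapTotal j))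
  ... | yes g≤ = Sum.map extend count-rest (greedy j (suc f ∸ g) (x₀ + g) rest≡Λ)
    where
    g = gap (suc j)
    rest≡Λ : x₀ + g + (suc f ∸ g) ≡ Λ
    rest≡Λ = trans (ℕP.+-assoc x₀ g _) (trans (cong (x₀ +_) (ℕP.m+[n∸m]≡n g≤)) x₀+f≡Λ)
    extend : Chain j (x₀ + g) → Chain (suc j) x₀
    extend ch = x₀ , ℕP.≤-refl , start<Λ x₀+f≡Λ , Rx₀ , ch
    count-rest : suc f ∸ g ≤ blueFrom (x₀ + g) (suc f ∸ g) + gapTotal j →
                 suc f ≤ blueFrom x₀ (suc f) + gapTotal (suc j)
    count-rest le = begin
        suc f
      ≡⟨ sym (ℕP.m∸n+n≡m g≤) ⟩
        (suc f ∸ g) + g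
      ≤⟨ ℕP.+-monoˡ-≤ g (ℕP.≤-trans le (ℕP.+-monoˡ-≤ (gapTotal j) (blueFrom-drop x₀ g (suc f) g≤))) ⟩
        blueFrom x₀ (suc f) + gapTotal j + g
      ≡⟨ ℕP.+-assoc (blueFrom x₀ (suc f)) (gapTotal j) g ⟩
        blueFrom x₀ (suc f) + (gapTotal j + g)
      ≡⟨ cong (blueFrom x₀ (suc f) +_) (sym (sumBelow-snoc j (gap ∘ suc))) ⟩
        blueFrom x₀ (suc f) + gapTotal (suc j)
      ∎
      where open ℕP.≤-Reasoning

pairs-below-3 : {P : ℕ → ℕ → Set} → P 0 1 → P 0 2 → P 1 2 → ∀ i j → i < j → j < 3 → P i j
pairs-below-3 p01 p02 p12 0 1 _ _ = p01
pairs-below-3 p01 p02 p12 0 2 _ _ = p02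
pairs-below-3 p01 p02 p12 1 2 _ _ = p12
pairs-below-3 p01 p02 p12 i 0 () _
pairs-below-3 p01 p02 p12 1 1 (s≤s ()) _
pairs-below-3 p01 p02 p12 (suc (suc i)) 1 (s≤s ()) _
pairs-below-3 p01 p02 p12 (suc (suc i)) 2 (s≤s (s≤s ())) _
pairs-below-3 p01 p02 p12 i (suc (suc (suc j))) _ (s≤s (s≤s (s≤s ())))

-- A colouring c of K_N, extended to all pairs of natural numbers (pairs
-- outside Fin N are red), and the translation of copies between the two.
module ExtendedColouring {N : ℕ} (c : Colouring N) where

  col : ℕ → ℕ → Bool
  col x y with x ℕ.<? N | y ℕ.<? N
  ... | yes x<N | yes y<N = c (fromℕ< x<N) (fromℕ< y<N)
  ... | _ | _ = true

  col-fin : ∀ {x y} (x<N : x < N) (y<N : y < N) → col x y ≡ c (fromℕ< x<N) (fromℕ< y<N)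
  col-fin {x} {y} x<N y<N with x ℕ.<? N | y ℕ.<? N
  ... | yes _ | yes _ = refl
  ... | no x≮N | _ = ⊥-elim (x≮N x<N)
  ... | yes _ | no y≮N = ⊥-elim (y≮N y<N)

  open RedEmbeddings col public

  BlueTriangle : Set
  BlueTriangle = MonoCopy K3 N c false

  copy : ∀ G b (g : ℕ → ℕ) → (∀ i j → i < j → j < n G → g i < g j) → (∀ i → i < n G → g i < N) →
    (∀ (i j : Fin (n G)) → i Fin.< j → E G i j → col (g (toℕ i)) (g (toℕ j)) ≡ b) → MonoCopy G N c b
  copy G b g inc g<N coloured = F , F-inc , F-coloured
    where
    F : Fin (n G) → Fin N
    F i = fromℕ< (g<N (toℕ i) (FinP.toℕ<n i))
    toℕ-F : ∀ i → toℕ (F i) ≡ g (toℕ i)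
    toℕ-F i = FinP.toℕ-fromℕ< _
    F-inc : ∀ i j → i Fin.< j → F i Fin.< F j
    F-inc i j i<j = subst₂ _<_ (sym (toℕ-F i)) (sym (toℕ-F j)) (inc (toℕ i) (toℕ j) i<j (FinP.toℕ<n j))
    F-coloured : ∀ i j → i Fin.< j → E G i j → c (F i) (F j) ≡ b
    F-coloured i j i<j e =
      trans (sym (col-fin (g<N (toℕ i) (FinP.toℕ<n i)) (g<N (toℕ j) (FinP.toℕ<n j)))) (coloured i j i<j e)

  red-copy : ∀ s f → RedEmbedding s f 0 N → MonoCopy (inducedMatching s) N c true
  red-copy s f e = copy (inducedMatching s) true f (RedEmbedding.increasing e)
    (λ i i<n → proj₂ (RedEmbedding.in-range e i i<n)) coloured
    where
    coloured : ∀ (i j : Fin (length s)) → i Fin.< j → E (inducedMatching s) i j →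
               Red (f (toℕ i)) (f (toℕ j))
    coloured i j i<j (inj₁ mem) = RedEmbedding.red-pairs e mem
    coloured i j i<j (inj₂ mem) = ⊥-elim (ℕP.<-asym i<j (proj₁ (matchedPair-bounds s mem)))

  blue-triangle : ∀ {u v w} → u < v → v < w → w < N →
    col u v ≡ false → col u w ≡ false → col v w ≡ false → BlueTriangle
  blue-triangle {u} {v} {w} u<v v<w w<N uv uw vw =
    copy K3 false corner (pairs-below-3 u<v (ℕP.<-trans u<v v<w) v<w) corner<N
      (λ i j i<j _ → pairs-below-3 {λ i j → col (corner i) (corner j) ≡ false} uv uw vw
                       (toℕ i) (toℕ j) i<j (FinP.toℕ<n j))
    where
    corner : ℕ → ℕ
    corner 0 = u
    corner 1 = v
    corner _ = w
    corner<N : ∀ i → i < 3 → corner i < N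
    corner<N 0 _ = ℕP.<-trans u<v (ℕP.<-trans v<w w<N)
    corner<N 1 _ = ℕP.<-trans v<w w<N
    corner<N (suc (suc i)) _ = w<N

  window : ℕ → (m : ℕ) → Colouring m
  window lo m a b = col (lo + toℕ a) (lo + toℕ b)

  embedding-from-copy : ∀ s lo m → MonoCopy (inducedMatching s) m (window lo m) true →
    Σ (ℕ → ℕ) λ f → RedEmbedding s f lo (lo + m)
  embedding-from-copy s lo m (F , F-inc , F-red) = (λ q → lo + extend q) , mkRedEmbedding inc rng red
    where
    extend : ℕ → ℕ
    extend q with q ℕ.<? length s
    ... | yes q<n = toℕ (F (fromℕ< q<n))
    ... | no _ = 0
    extend-fin : ∀ {q} (q<n : q < length s) → extend q ≡ toℕ (F (fromℕ< q<n))
    extend-fin {q} q<n with q ℕ.<? length s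
    ... | yes _ = refl
    ... | no q≮n = ⊥-elim (q≮n q<n)
    fromℕ<-< : ∀ {i j} (i<n : i < length s) (j<n : j < length s) → i < j → fromℕ< i<n Fin.< fromℕ< j<n
    fromℕ<-< i<n j<n = subst₂ _<_ (sym (FinP.toℕ-fromℕ< i<n)) (sym (FinP.toℕ-fromℕ< j<n))
    inc : ∀ i j → i < j → j < length s → lo + extend i < lo + extend j
    inc i j i<j j<n = let i<n = ℕP.<-trans i<j j<n in ℕP.+-monoʳ-< lo
      (subst₂ _<_ (sym (extend-fin i<n)) (sym (extend-fin j<n)) (F-inc _ _ (fromℕ<-< i<n j<n i<j)))
    rng : ∀ i → i < length s → lo ≤ lo + extend i × lo + extend i < lo + m
    rng i i<n = ℕP.m≤m+n lo (extend i) ,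
                ℕP.+-monoʳ-< lo (subst (_< m) (sym (extend-fin i<n)) (FinP.toℕ<n _))
    red : ∀ {q p} → (q , p) ∈ matchedPairs s → Red (lo + extend q) (lo + extend p)
    red {q} {p} mem =
      subst₂ (λ a b → Red (lo + a) (lo + b)) (sym (extend-fin q<n)) (sym (extend-fin p<n))
        (F-red _ _ (fromℕ<-< q<n p<n q<p)
          (inj₁ (subst₂ (λ a b → (a , b) ∈ matchedPairs s)
                        (sym (FinP.toℕ-fromℕ< q<n)) (sym (FinP.toℕ-fromℕ< p<n)) mem)))
      where
      q<p : q < p
      q<p = proj₁ (matchedPair-bounds s mem)
      p<n : p < length s
      p<n = proj₂ (matchedPair-bounds s mem)
      q<n : q < length s
      q<n = ℕP.<-trans q<p p<n

  arrows-in-window : ∀ s m lo → Arrows (inducedMatching s) K3 m → lo + m ≤ N →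
    (Σ (ℕ → ℕ) λ f → RedEmbedding s f lo (lo + m)) ⊎ BlueTriangle
  arrows-in-window s m lo arrows lo+m≤N with arrows (window lo m)
  ... | inj₁ red-copy-in-window = inj₁ (embedding-from-copy s lo m red-copy-in-window)
  ... | inj₂ (T , T-inc , T-blue) = inj₂ (blue-triangle
          (ℕP.+-monoʳ-< lo (T-inc fz (fs fz) (s≤s z≤n)))
          (ℕP.+-monoʳ-< lo (T-inc (fs fz) (fs (fs fz)) (s≤s (s≤s z≤n))))
          (ℕP.<-≤-trans (ℕP.+-monoʳ-< lo (FinP.toℕ<n (T (fs (fs fz))))) lo+m≤N)
          (T-blue fz (fs fz) (s≤s z≤n) λ ())
          (T-blue fz (fs (fs fz)) (s≤s z≤n) λ ())
          (T-blue (fs fz) (fs (fs fz)) (s≤s (s≤s z≤n)) λ ()))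

module Construction (k′ : ℕ) (A : ℕ → List Paren)
  (balanced : ∀ i → 1 ≤ i → i ≤ 2 * suc k′ ∸ 1 → Balanced (A i))
  (r : ℕ → ℕ)
  (ramsey : ∀ i → 1 ≤ i → i ≤ 2 * suc k′ ∸ 1 → IsOrdRamsey (inducedMatching (A i)) K3 (r i)) where

  k : ℕ
  k = suc k′

  left right : ℕ → ℕ
  left j = k ∸ suc j
  right j = k + suc j

  InRange : ℕ → Set
  InRange i = 1 ≤ i × i ≤ 2 * k ∸ 1

  2k∸1≡k+k′ : 2 * k ∸ 1 ≡ k + k′
  2k∸1≡k+k′ = trans (cong (λ z → k′ + suc z) (ℕP.+-identityʳ k′)) (ℕP.+-suc k′ k′)

  middle-in-range : InRange k
  middle-in-range = s≤s z≤n , subst (k ≤_) (sym 2k∸1≡k+k′) (ℕP.m≤m+n k k′)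

  left-in-range : ∀ {j} → j < k′ → InRange (left j)
  left-in-range {j} j<k′ = ℕP.m<n⇒0<n∸m (s≤s j<k′) ,
    subst (left j ≤_) (sym 2k∸1≡k+k′) (ℕP.≤-trans (ℕP.m∸n≤m k (suc j)) (ℕP.m≤m+n k k′))

  right-in-range : ∀ {j} → j < k′ → InRange (right j)
  right-in-range {j} j<k′ = ℕP.≤-trans (s≤s z≤n) (ℕP.m≤m+n k (suc j)) ,
    subst (right j ≤_) (sym 2k∸1≡k+k′) (ℕP.+-monoʳ-≤ k j<k′)

  balanced-at : ∀ {i} → InRange i → Balanced (A i)
  balanced-at (1≤i , i≤) = balanced _ 1≤i i≤

  arrows-at : ∀ {i} → InRange i → Arrows (inducedMatching (A i)) K3 (r i)
  arrows-at (1≤i , i≤) = proj₁ (ramsey _ 1≤i i≤)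

  length≤r : ∀ {i} → InRange i → length (A i) ≤ r i
  length≤r in-range = length≤arrows (A _) (r _) (arrows-at in-range)

  layerSum : ℕ → ℕ
  layerSum = sumBelow (λ i → r (left i) + r (right i))

  -- gap (j + 1) = 1 + r (left j) + r (right j) is reserved around layer j + 1.
  gap : ℕ → ℕ
  gap j = suc (r (k ∸ j) + r (k + j))

  L : ℕ
  L = sumExceptMiddle r k

  layerSum-all : layerSum k′ ≡ L
  layerSum-all = begin
      layerSum k′
    ≡⟨ sumBelow-+ k′ (r ∘ left) (r ∘ right) ⟩
      sumBelow (r ∘ left) k′ + sumBelow (r ∘ right) k′
    ≡⟨ cong₂ _+_ (sym left-sum) (sym (sum-map-upTo k′ (r ∘ right))) ⟩
      L
    ∎
    where
    open ≡-Reasoning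
    left-sum : sum (map (λ j → r (suc j)) (upTo k′)) ≡ sumBelow (r ∘ left) k′
    left-sum = trans (sum-map-upTo k′ (r ∘ suc)) (trans (sumBelow-reverse k′ (r ∘ suc))
      (sumBelow-cong k′ λ i i<k′ → cong r (sym (ℕP.+-∸-assoc 1 i<k′))))

  layer : ℕ → List Paren
  layer = nestLayer A k

  layer-suc : ∀ j → layer (suc j) ≡ op ∷ (A (left j) ++ (layer j ++ A (right j))) ++ [ cl ]
  layer-suc j = cong (op ∷_) (sym (trans (ListP.++-assoc (A (left j)) (layer j ++ A (right j)) [ cl ])
                  (cong (A (left j) ++_) (ListP.++-assoc (layer j) (A (right j)) [ cl ]))))

  layer-inside-balanced : ∀ j → suc j ≤ k′ → Balanced (layer j) →
    Balanced (A (left j) ++ (layer j ++ A (right j)))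
  layer-inside-balanced j j<k′ bal =
    balanced-++ (balanced-at (left-in-range j<k′)) (balanced-++ bal (balanced-at (right-in-range j<k′)))

  layer-balanced : ∀ j → j ≤ k′ → Balanced (layer j)
  layer-balanced zero _ = bal-wrap (balanced-at middle-in-range) bal-nil
  layer-balanced (suc j) j<k′ = subst Balanced (sym (layer-suc j))
    (bal-wrap (layer-inside-balanced j j<k′ (layer-balanced j (ℕP.<⇒≤ j<k′))) bal-nil)

  -- Each A i has at most r i positions, so layers are short.
  layer-length : ∀ j → j ≤ k′ → length (layer j) ≤ 2 * suc j + length (A k) + layerSum j
  layer-length zero _ = ℕP.≤-reflexive (trans (cong suc (ListP.length-++ (A k))) (arith (length (A k))))
    where
    arith : ∀ a → suc (a + 1) ≡ 2 * 1 + a + 0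
    arith = solve-∀
  layer-length (suc j) j<k′ = begin
      length (layer (suc j))
    ≡⟨ cong length (layer-suc j) ⟩
      suc (length ((A (left j) ++ (layer j ++ A (right j))) ++ [ cl ]))
    ≡⟨ cong suc (trans (ListP.length-++ (A (left j) ++ _)) (cong (_+ 1) (trans (ListP.length-++ (A (left j)))
         (cong (length (A (left j)) +_) (ListP.length-++ (layer j)))))) ⟩
      suc (length (A (left j)) + (length (layer j) + length (A (right j))) + 1)
    ≤⟨ s≤s (ℕP.+-monoˡ-≤ 1 (ℕP.+-mono-≤ (length≤r (left-in-range j<k′))
         (ℕP.+-mono-≤ (layer-length j (ℕP.<⇒≤ j<k′)) (length≤r (right-in-range j<k′))))) ⟩
      suc (r (left j) + ((2 * suc j + length (A k) + layerSum j) + r (right j)) + 1)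
    ≡⟨ arith (r (left j)) (r (right j)) j (length (A k)) (layerSum j) ⟩
      2 * suc (suc j) + length (A k) + (layerSum j + (r (left j) + r (right j)))
    ≡⟨ cong (2 * suc (suc j) + length (A k) +_) (sym (sumBelow-snoc j (λ i → r (left i) + r (right i)))) ⟩
      2 * suc (suc j) + length (A k) + layerSum (suc j)
    ∎
    where
    open ℕP.≤-Reasoning
    arith : ∀ a b j n s → suc (a + ((2 * suc j + n + s) + b) + 1) ≡ 2 * suc (suc j) + n + (s + (a + b))
    arith = solve-∀

  -- The parameters of the colouring argument: D = |M|; points below Λ are
  -- the left ends, [Λ, Λ + t) hosts A k, and S columns of right ends follow.
  M : List Paren
  M = nested A k

  D G Λ S t N : ℕ
  D = length M
  G = sumBelow (gap ∘ suc) k′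
  Λ = suc (G + G)
  S = D + D
  t = r k
  N = Λ + t + S + Λ

  D-bound : D ≤ 2 * k + length (A k) + L
  D-bound = subst (λ z → D ≤ 2 * k + length (A k) + z) layerSum-all (layer-length k′ ℕP.≤-refl)

  G≡k′+L : G ≡ k′ + L
  G≡k′+L = trans (sumBelow-+ k′ (λ _ → 1) (λ i → r (left i) + r (right i)))
                 (cong₂ _+_ (trans (sumBelow-const k′ 1) (ℕP.*-identityʳ k′)) layerSum-all)

  N-bound : N ≤ t + 20 * (k + L + length (A k))
  N-bound = begin
      Λ + t + S + Λ
    ≤⟨ ℕP.+-monoˡ-≤ Λ (ℕP.+-monoʳ-≤ (Λ + t) (ℕP.+-mono-≤ D-bound D-bound)) ⟩
      Λ + t + (B + B) + Λ
    ≡⟨ cong (λ g → suc (g + g) + t + (B + B) + suc (g + g)) G≡k′+L ⟩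
      suc ((k′ + L) + (k′ + L)) + t + (B + B) + suc ((k′ + L) + (k′ + L))
    ≡⟨ collect k′ L a t ⟩
      t + (6 + 8 * k′ + 6 * L + 2 * a)
    ≤⟨ ℕP.+-monoʳ-≤ t (ℕP.m≤m+n _ (14 + 12 * k′ + 14 * L + 18 * a)) ⟩
      t + (6 + 8 * k′ + 6 * L + 2 * a + (14 + 12 * k′ + 14 * L + 18 * a))
    ≡⟨ cong (t +_) (fill k′ L a) ⟩
      t + 20 * (k + L + a)
    ∎
    where
    open ℕP.≤-Reasoning
    a = length (A k)
    B = 2 * k + a + L
    collect : ∀ k L a t → suc ((k + L) + (k + L)) + t + ((2 * suc k + a + L) + (2 * suc k + a + L)) +
      suc ((k + L) + (k + L)) ≡ t + (6 + 8 * k + 6 * L + 2 * a)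
    collect = solve-∀
    fill : ∀ k L a → 6 + 8 * k + 6 * L + 2 * a + (14 + 12 * k + 14 * L + 18 * a) ≡ 20 * (suc k + L + a)
    fill = solve-∀

  -- The right end matched with the left end x in column s; for fixed s it
  -- decreases as x increases, so the pairs (x , partner x s) are nested.
  partner : ℕ → ℕ → ℕ
  partner x s = Λ + t + s + (Λ ∸ suc x)

  partner-low : ∀ x s → Λ + t ≤ partner x s
  partner-low x s = ℕP.≤-trans (ℕP.m≤m+n (Λ + t) s) (ℕP.m≤m+n _ _)

  partner<N : ∀ x {s} → s < S → partner x s < N
  partner<N x s<S = ℕP.+-mono-<-≤ (ℕP.+-monoʳ-< (Λ + t) s<S) (ℕP.m∸n≤m Λ (suc x))

  partner-increasing : ∀ x {s s′} → s < s′ → partner x s < partner x s′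
  partner-increasing x s<s′ = ℕP.+-monoˡ-< (Λ ∸ suc x) (ℕP.+-monoʳ-< (Λ + t) s<s′)

  partner-antitone : ∀ {x x′} s → x ≤ x′ → partner x′ s ≤ partner x s
  partner-antitone s x≤x′ = ℕP.+-monoʳ-≤ (Λ + t + s) (ℕP.∸-monoʳ-≤ Λ (s≤s x≤x′))

  left<partner : ∀ x s → x < Λ → x < partner x s
  left<partner x s x<Λ = ℕP.<-≤-trans x<Λ (ℕP.≤-trans (ℕP.m≤m+n Λ t) (partner-low x s))

  partner-shift : ∀ x g s → x + g < Λ → partner (x + g) s + g ≡ partner x s
  partner-shift x g s x+g<Λ = trans (ℕP.+-assoc (Λ + t + s) d g) (cong (Λ + t + s +_) d+g)
    where
    open ≡-Reasoning
    d = Λ ∸ suc (x + g)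
    d+g : d + g ≡ Λ ∸ suc x
    d+g = sym (begin
        Λ ∸ suc x
      ≡⟨ cong (_∸ suc x) (sym (ℕP.m∸n+n≡m x+g<Λ)) ⟩
        (d + suc (x + g)) ∸ suc x
      ≡⟨ ℕP.+-∸-assoc d (s≤s (ℕP.m≤m+n x g)) ⟩
        d + (suc (x + g) ∸ suc x)
      ≡⟨ cong (d +_) (ℕP.m+n∸m≡n x g) ⟩
        d + g
      ∎)

  Λ+t≤N : Λ + t ≤ N
  Λ+t≤N = ℕP.≤-trans (ℕP.m≤m+n (Λ + t) S) (ℕP.m≤m+n (Λ + t + S) Λ)

  left-block-end : ∀ x j → suc x + r (left j) ≤ x + gap (suc j)
  left-block-end x j = subst (suc x + r (left j) ≤_) (sym (ℕP.+-suc x _))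
                             (ℕP.+-monoʳ-≤ (suc x) (ℕP.m≤m+n (r (left j)) (r (right j))))

  right-block≤partner : ∀ x s j → x + gap (suc j) < Λ → r (right j) ≤ partner x s
  right-block≤partner x s j x+g<Λ = ℕP.≤-trans (ℕP.m≤n+m (r (right j)) (suc (r (left j))))
    (subst (gap (suc j) ≤_) (partner-shift x (gap (suc j)) s x+g<Λ)
           (ℕP.m≤n+m (gap (suc j)) (partner (x + gap (suc j)) s)))

  module ColouringArgument (c : Colouring N) where
    open ExtendedColouring c

    Outcome : Set
    Outcome = MonoCopy (inducedMatching M) N c true ⊎ BlueTriangle

    _>>=_ : {X Y : Set} → X ⊎ BlueTriangle → (X → Y ⊎ BlueTriangle) → Y ⊎ BlueTriangle
    inj₁ x >>= next = next x
    inj₂ blue >>= _ = inj₂ blue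

    module Column (s : ℕ) = GreedyChain (λ x → col x (partner x s)) gap Λ

    LayerEmbedding : ℕ → ℕ → ℕ → Set
    LayerEmbedding s j x₀ = Σ (ℕ → ℕ) λ h → RedEmbedding (layer j) h x₀ (suc (partner x₀ s))

    -- Layer j + 1 around the red edge x — y (y = partner x s), assembled from
    -- layer j starting at x + gap (j + 1) and the two new blocks placed in
    -- the gaps [x + 1, x + 1 + r (left j)) and [y - r (right j), y).
    assemble : ∀ s j x {h fL fR} → suc j ≤ k′ → x + gap (suc j) < Λ → Red x (partner x s) →
      RedEmbedding (layer j) h (x + gap (suc j)) (suc (partner (x + gap (suc j)) s)) →
      RedEmbedding (A (left j)) fL (suc x) (suc x + r (left j)) →
      RedEmbedding (A (right j)) fR (partner x s ∸ r (right j))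
                                    (partner x s ∸ r (right j) + r (right j)) →
      Σ (ℕ → ℕ) λ h′ → RedEmbedding (layer (suc j)) h′ x (suc (partner x s))
    assemble s j x {h} {fL} {fR} j<k′ x+g<Λ red-xy e-layer e-left e-right =
      h′ , subst (λ X → RedEmbedding X h′ x (suc y)) (sym (layer-suc j))
            (wrap (layer-inside-balanced j j<k′ (layer-balanced j (ℕP.<⇒≤ j<k′)))
                  (left<partner x s x<Λ) red-xy
              (concat (balanced-at (left-in-range j<k′)) (ℕP.≤-trans (ℕP.m≤m+n (suc x) rL) left-end) x+g≤y
                (widen ℕP.≤-refl left-end e-left)
                (concat (layer-balanced j (ℕP.<⇒≤ j<k′)) x+g≤y-rR (ℕP.m∸n≤m y rR)
                  (widen ℕP.≤-refl inner-end e-layer)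
                  (widen ℕP.≤-refl (ℕP.≤-reflexive (ℕP.m∸n+n≡m rR≤y)) e-right))))
      where
      rL = r (left j)
      rR = r (right j)
      g = gap (suc j)
      y = partner x s
      y′ = partner (x + g) s
      h′ : ℕ → ℕ
      h′ = wrapMap x y (length (A (left j) ++ (layer j ++ A (right j))))
                   (join (length (A (left j))) fL (join (length (layer j)) h fR))
      x<Λ : x < Λ
      x<Λ = ℕP.≤-<-trans (ℕP.m≤m+n x g) x+g<Λ
      y′+g≡y : y′ + g ≡ y
      y′+g≡y = partner-shift x g s x+g<Λ
      left-end : suc x + rL ≤ x + g
      left-end = left-block-end x j
      rR≤y : rR ≤ y
      rR≤y = right-block≤partner x s j x+g<Λ
      inner-end : suc y′ ≤ y ∸ rR
      inner-end = ℕP.m+n≤o⇒m≤o∸n (suc y′) (subst (suc y′ + rR ≤_) y′+g≡y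
                    (subst (_≤ y′ + g) (ℕP.+-suc y′ rR) (ℕP.+-monoʳ-≤ y′ (s≤s (ℕP.m≤n+m rR rL)))))
      x+g≤y-rR : x + g ≤ y ∸ rR
      x+g≤y-rR = ℕP.≤-trans (ℕP.<⇒≤ (left<partner (x + g) s x+g<Λ)) (ℕP.≤-trans (ℕP.n≤1+n y′) inner-end)
      x+g≤y : x + g ≤ y
      x+g≤y = ℕP.≤-trans x+g≤y-rR (ℕP.m∸n≤m y rR)

    layer-from-chain : ∀ s → s < S → ∀ j → j ≤ k′ → ∀ x₀ → Column.Chain s j x₀ →
      LayerEmbedding s j x₀ ⊎ BlueTriangle
    layer-from-chain s s<S zero _ x₀ (x , x₀≤x , x<Λ , red) = do
      (f , e) ← arrows-in-window (A k) t Λ (arrows-at middle-in-range) Λ+t≤N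
      inj₁ (_ , widen x₀≤x (s≤s (partner-antitone s x₀≤x))
                  (wrap (balanced-at middle-in-range) (left<partner x s x<Λ) red
                        (widen x<Λ (partner-low x s) e)))
    layer-from-chain s s<S (suc j) j<k′ x₀ (x , x₀≤x , x<Λ , red , chain) = do
      (h , e-layer) ← layer-from-chain s s<S j (ℕP.<⇒≤ j<k′) (x + gap (suc j)) chain
      (fL , e-left) ← arrows-in-window (A (left j)) (r (left j)) (suc x)
                                      (arrows-at (left-in-range j<k′)) left-fits
      (fR , e-right) ← arrows-in-window (A (right j)) (r (right j)) (partner x s ∸ r (right j))
                                       (arrows-at (right-in-range j<k′)) right-fits
      let (h′ , e) = assemble s j x j<k′ x+g<Λ red e-layer e-left e-right
      inj₁ (h′ , widen x₀≤x (s≤s (partner-antitone s x₀≤x)) e)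
      where
      x+g<Λ : x + gap (suc j) < Λ
      x+g<Λ = Column.chain-head s j chain
      left-fits : suc x + r (left j) ≤ N
      left-fits = ℕP.≤-trans (left-block-end x j)
                             (ℕP.≤-trans (ℕP.<⇒≤ x+g<Λ) (ℕP.≤-trans (ℕP.m≤m+n Λ t) Λ+t≤N))
      right-fits : partner x s ∸ r (right j) + r (right j) ≤ N
      right-fits = subst (_≤ N) (sym (ℕP.m∸n+n≡m (right-block≤partner x s j x+g<Λ)))
                         (ℕP.<⇒≤ (partner<N x s<S))

    rowBlue : ℕ → ℕ
    rowBlue x = sumBelow (λ s → blueIndicator (col x (partner x s))) S

    chain-route : ∀ s → s < S → Column.Chain s k′ 0 → Outcome
    chain-route s s<S chain = do
      (h , e) ← layer-from-chain s s<S k′ ℕP.≤-refl 0 chain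
      inj₁ (red-copy M h (widen ℕP.≤-refl (partner<N 0 s<S) e))

    -- A left end x with D blue edges to partners: their other ends span
    -- a red clique (containing M) or a blue edge (a blue triangle with x).
    clique-route : ∀ x → x < Λ → D ≤ rowBlue x → Outcome
    clique-route x x<Λ D≤row with blue-positions (λ s → col x (partner x s)) S D D≤row
    ... | g , g<S , g-inc , g-blue
        with all-pairs-or-failure D (λ i j → col (partner x (g i)) (partner x (g j)))
    ...   | inj₂ all-red = inj₁ (red-copy M f (clique M f 0 N
              (λ i j i<j j<D → partner-increasing x (g-inc i j i<j j<D))
              (λ i i<D → z≤n , partner<N x (g<S i i<D)) all-red))
      where
      f : ℕ → ℕ
      f i = partner x (g i)
    ...   | inj₁ (i , j , i<j , j<D , blue) = inj₂ (blue-triangle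
              (left<partner x (g i) x<Λ) (partner-increasing x (g-inc i j i<j j<D))
              (partner<N x (g<S j j<D))
              (g-blue i (ℕP.<-trans i<j j<D)) (g-blue j j<D) blue)

    -- Either some row has D blue entries, or some column has a full-depth
    -- greedy chain; otherwise every row has fewer than D blue entries and
    -- every column at most G red ones, contradicting double counting.
    outcome : Outcome
    outcome with bounded-choice Λ (λ x → ℕP.≤-<-connex D (rowBlue x))
    ... | inj₁ (x , x<Λ , D≤row) = clique-route x x<Λ D≤row
    ... | inj₂ rows-small with bounded-choice S (λ s → Column.greedy s k′ Λ 0 refl)
    ...   | inj₁ (s , s<S , chain) = chain-route s s<S chain
    ...   | inj₂ columns =
      ⊥-elim (double-counting D G (λ x s → col x (partner x s)) rows-small columns)

  arrows : Arrows (inducedMatching M) K3 N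
  arrows c = ColouringArgument.outcome c

lemma5 : (k : ℕ) → 1 ≤ k → (A : ℕ → List Paren) →
    (∀ i → 1 ≤ i → i ≤ 2 * k ∸ 1 → Balanced (A i)) →
    (r : ℕ → ℕ) →
    (∀ i → 1 ≤ i → i ≤ 2 * k ∸ 1 → IsOrdRamsey (inducedMatching (A i)) K3 (r i)) →
    ∃ λ R → IsOrdRamsey (inducedMatching (nested A k)) K3 R ×
      R ≤ r k + 20 * (k + sumExceptMiddle r k + length (A k))
lemma5 zero () A balanced r ramsey
lemma5 (suc k′) _ A balanced r ramsey =
  let (R , R-ramsey , R≤N) = ramsey-exists (inducedMatching M) K3 (matching-edges? M) K3-edges? N arrows
  in R , R-ramsey , ℕP.≤-trans R≤N N-bound
  where open Construction k′ A balanced r ramsey
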